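{- Let $d_2(n)$ be the number of $2$-distant noncrossing partitions of $[n]$. Then $d_2(0)=d_2(1)=1$, and for $n\geq 2$, $$d_2(n)=2d_2(n-1) + \sum_{i=2}^{n-1} d_2(n-i)\left(d_2(i)-d_2(i-1)\right).$$
   Context: A partition of $[n]$ is a set of pairwise disjoint nonempty blocks with union $[n]$ ($[0]=\emptyset$ has one partition). A standard edge of a partition is a pair $(i,j)$ with $i<j$ in the same block such that no element $t$ of that block satisfies $i<t<j$. For $k\ge1$, a $k$-distant crossing is a pair of standard edges $(i_1,j_1),(i_2,j_2)$ with $i_1<i_2<j_1<j_2$ and $j_1-i_2\ge k$. A $k$-distant noncrossing partition is one with no $k$-distant crossing. -}

module Defs where

open import Data.Nat using (ℕ; zero; suc; _∸_; _≤_)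
import Data.Nat
open import Data.Fin using (Fin; toℕ; _<_)
open import Data.Bool using (Bool; T)
open import Data.Vec using (Vec; lookup)
open import Data.Product using (_×_; ∃-syntax)
open import Data.List using (map; applyUpTo; foldr)
open import Data.Integer using (ℤ; _+_)
open import Data.Integer using () renaming (0ℤ to zeroℤ)
open import Relation.Nullary using (¬_)
open import Relation.Binary.Structures using (IsEquivalence)

-- A partition of [n] (elements represented by Fin n, i.e. 0..n-1; only
-- differences of positions matter) is given by its "same block" relation,
-- an equivalence relation on Fin n stored as an n×n Boolean matrix.
Matrix : ℕ → Set
Matrix n = Vec (Vec Bool n) n

SameBlock : ∀ {n} → Matrix n → Fin n → Fin n → Set
SameBlock M i j = T (lookup (lookup M i) j)

StandardEdge : ∀ {n} → Matrix n → Fin n → Fin n → Set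
StandardEdge M i j =
  i < j × SameBlock M i j × (∀ t → i < t → t < j → ¬ SameBlock M i t)

DistantCrossing : ℕ → ∀ {n} → Matrix n → Set
DistantCrossing k M =
  ∃[ i₁ ] ∃[ j₁ ] ∃[ i₂ ] ∃[ j₂ ]
    (StandardEdge M i₁ j₁ × StandardEdge M i₂ j₂ ×
     i₁ < i₂ × i₂ < j₁ × j₁ < j₂ × k ≤ toℕ j₁ ∸ toℕ i₂)

-- k-distant noncrossing partitions of [n]; the proof fields are irrelevant,
-- so two such partitions are equal iff their block relations are equal.
record NoncrossingPartition (k n : ℕ) : Set where
  field
    blocks      : Matrix n
    .isPartition : IsEquivalence (SameBlock blocks)
    .noncrossing : ¬ DistantCrossing k blocks

-- Σ_{i=2}^{n-1} f i  (empty when n ≤ 2)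
sumFrom2 : ℕ → (ℕ → ℤ) → ℤ
sumFrom2 n f = foldr _+_ zeroℤ (map f (applyUpTo (2 Data.Nat.+_) (n ∸ 2)))

module Submission where

-- Encode a partition of [n] by its predecessor map: j ↦ 0 if j opens its block,
-- j ↦ 1 + i if (i , j) is a standard edge; the blocks are recovered by following
-- predecessors down to block minima.  Being 2-distant noncrossing says that
-- standard edges (a , j₁), (b , j₂) with a < b < j₁ < j₂ have j₁ = b + 1.
-- Let d n count such maps on [n], and u m those on [m + 2] in which m + 1 does
-- not directly follow m.  Deleting the last element when it follows its
-- neighbour gives d (n + 2) = u n + d (n + 1).  Otherwise n + 1 opens a block
-- (d (n + 1) ways) or follows some m < n.  Then no edge from below m ends inside
-- (m , n + 1) except at m + 1, so the partition is an outer one on [0 , m + 1],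
-- in which m + 1 does not follow m, glued at m + 1 to an arbitrary inner one on
-- [m + 1 , n].  Hence u n = d (n + 1) + Σ_{m<n} u m · d (n − m), and
-- eliminating u with the first identity gives the recurrence.

module TwoDistantNoncrossing where

  open import Data.Bool using (Bool; true; false; T; if_then_else_)
  import Data.Bool.Properties as Bool
  open import Data.Empty using (⊥; ⊥-elim)
  import Data.Empty.Irrelevant as Irrelevant
  open import Data.Fin using (Fin; toℕ; fromℕ<) renaming (zero to fzero; suc to fsuc)
  open import Data.Fin.Permutation using (↔⇒≡)
  open import Data.Fin.Properties using (toℕ<n; toℕ-fromℕ<; toℕ-injective; +↔⊎; *↔×)
  open import Data.Nat
  open import Data.Nat.Induction using (<-rec)
  open import Data.Nat.Properties
  open import Algebra.Properties.Monoid.Sum +-0-monoid using (sum; sum-syntax)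
  open import Data.Nat.Tactic.RingSolver using (solve-∀)
  open import Data.Product using (Σ; _×_; _,_; proj₁; proj₂)
  open import Data.Product.Function.Dependent.Propositional using (Σ-↔)
  open import Data.Product.Function.NonDependent.Propositional using (_×-↔_)
  open import Data.Sum using (_⊎_; inj₁; inj₂)
  open import Data.Sum.Function.Propositional using (_⊎-↔_)
  open import Data.Unit using (⊤; tt)
  open import Data.Vec using (Vec; []; _∷_; lookup; tabulate; replicate)
  open import Function using (_∘′_)
  open import Function.Bundles using (_↔_; mk↔ₛ′)
  open import Function.Properties.Inverse using (↔-refl; ↔-trans; ↔-sym)
  open import Relation.Binary.Definitions using (tri<; tri≈; tri>)
  open import Relation.Binary.PropositionalEquality
  open import Relation.Binary.Structures using (IsEquivalence)
  open import Relation.Nullary using (¬_; Dec; yes; no)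
  open import Relation.Nullary.Decidable using (recompute)

  open import Defs

  lookupOr : ∀ {A : Set} {n} → A → Vec A n → ℕ → A
  lookupOr d []      _       = d
  lookupOr d (x ∷ v) zero    = x
  lookupOr d (x ∷ v) (suc i) = lookupOr d v i

  lookupOr-toℕ : ∀ {A : Set} {n} (d : A) (v : Vec A n) (i : Fin n) → lookupOr d v (toℕ i) ≡ lookup v i
  lookupOr-toℕ d (x ∷ v) fzero    = refl
  lookupOr-toℕ d (x ∷ v) (fsuc i) = lookupOr-toℕ d v i

  tabulateℕ : ∀ {A : Set} n → (ℕ → A) → Vec A n
  tabulateℕ n f = tabulate (λ i → f (toℕ i))

  lookupOr-tabulateℕ : ∀ {A : Set} (d : A) n (f : ℕ → A) {j} → j < n → lookupOr d (tabulateℕ n f) j ≡ f j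
  lookupOr-tabulateℕ d (suc n) f {zero}  _         = refl
  lookupOr-tabulateℕ d (suc n) f {suc j} (s≤s j<n) = lookupOr-tabulateℕ d n (f ∘′ suc) j<n

  lookupOr-ext : ∀ {A : Set} {n} (d : A) (u v : Vec A n) →
                 (∀ {j} → j < n → lookupOr d u j ≡ lookupOr d v j) → u ≡ v
  lookupOr-ext d []      []      _  = refl
  lookupOr-ext d (x ∷ u) (y ∷ v) eq = cong₂ _∷_ (eq z<s) (lookupOr-ext d u v (λ j<n → eq (s≤s j<n)))

  -- Predecessor maps

  -- π j ≡ suc i encodes the standard edge (i , j); the last field says j₁ ∸ b < 2.
  record IsPredMap (n : ℕ) (π : ℕ → ℕ) : Set where
    field
      pred<             : ∀ {j i} → j < n → π j ≡ suc i → i < j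
      succ-unique       : ∀ {j j′ i} → j < n → j′ < n → π j ≡ suc i → π j′ ≡ suc i → j ≡ j′
      noDistantCrossing : ∀ {j₁ j₂ a b} → j₂ < n → π j₁ ≡ suc a → π j₂ ≡ suc b →
                          a < b → b < j₁ → j₁ < j₂ → j₁ ≤ suc b
  open IsPredMap public

  IsPredMap-cong : ∀ {n π ψ} → (∀ {j} → j < n → π j ≡ ψ j) → IsPredMap n π → IsPredMap n ψ
  IsPredMap-cong π≗ψ P = record
    { pred<             = λ j<n e → pred< P j<n (trans (π≗ψ j<n) e)
    ; succ-unique       = λ j<n j′<n e e′ →
        succ-unique P j<n j′<n (trans (π≗ψ j<n) e) (trans (π≗ψ j′<n) e′)
    ; noDistantCrossing = λ j₂<n e e′ a<b b<j₁ j₁<j₂ →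
        noDistantCrossing P j₂<n (trans (π≗ψ (<-trans j₁<j₂ j₂<n)) e) (trans (π≗ψ j₂<n) e′)
          a<b b<j₁ j₁<j₂ }

  IsPredMap-restrict : ∀ {n k π} → k ≤ n → IsPredMap n π → IsPredMap k π
  IsPredMap-restrict k≤n P = record
    { pred<             = λ j<k → pred< P (<-≤-trans j<k k≤n)
    ; succ-unique       = λ j<k j′<k → succ-unique P (<-≤-trans j<k k≤n) (<-≤-trans j′<k k≤n)
    ; noDistantCrossing = λ j₂<k → noDistantCrossing P (<-≤-trans j₂<k k≤n) }

  pred≤ : ∀ {n π j} → IsPredMap n π → j < n → π j ≤ j
  pred≤ {π = π} {j} P j<n with π j in e
  ... | zero  = z≤n
  ... | suc i = pred< P j<n e

  pred-0≡0 : ∀ {n π} → IsPredMap n π → 0 < n → π 0 ≡ 0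
  pred-0≡0 {π = π} P 0<n with π 0 in e
  ... | zero  = refl
  ... | suc i with () ← pred< P 0<n e

  setAt : ℕ → ℕ → (ℕ → ℕ) → ℕ → ℕ
  setAt k x f j with j ≟ k
  ... | yes _ = x
  ... | no  _ = f j

  setAt-here : ∀ k x f → setAt k x f k ≡ x
  setAt-here k x f with k ≟ k
  ... | yes _   = refl
  ... | no  k≢k = ⊥-elim (k≢k refl)

  setAt-there : ∀ {k j} x f → j ≢ k → setAt k x f j ≡ f j
  setAt-there {k} {j} x f j≢k with j ≟ k
  ... | yes j≡k = ⊥-elim (j≢k j≡k)
  ... | no  _   = refl

  module SetLastIsPredMap {k f} x (x∈ : x ≡ 0 ⊎ x ≡ suc k) (P : IsPredMap (suc k) f) where

    private
      g : ℕ → ℕ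
      g = setAt (suc k) x f

      below : ∀ {j} → j < suc k → g j ≡ f j
      below j<1+k = setAt-there x f (λ j≡1+k → <-irrefl j≡1+k j<1+k)

      lastPred : ∀ {t} → g (suc k) ≡ suc t → t ≡ k
      lastPred {t} e = case x∈
        where
        case : x ≡ 0 ⊎ x ≡ suc k → t ≡ k
        case (inj₁ x≡0)   = ⊥-elim (0≢1+n (trans (sym x≡0) (trans (sym (setAt-here (suc k) x f)) e)))
        case (inj₂ x≡1+k) = suc-injective (trans (sym e) (trans (setAt-here (suc k) x f) x≡1+k))

      noSuccessorOfLast : ∀ {j} → j < suc k → f j ≢ suc k
      noSuccessorOfLast j<1+k e = <-irrefl refl (<-≤-trans (pred< P j<1+k e) (m<1+n⇒m≤n j<1+k))

    setLast-pred< : ∀ {j t} → j < suc (suc k) → g j ≡ suc t → t < j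
    setLast-pred< j< e with m<1+n⇒m<n∨m≡n j<
    ... | inj₂ refl  = s≤s (≤-reflexive (lastPred e))
    ... | inj₁ j<1+k = pred< P j<1+k (trans (sym (below j<1+k)) e)

    setLast-succ-unique : ∀ {j j′ i} → j < suc (suc k) → j′ < suc (suc k) →
                   g j ≡ suc i → g j′ ≡ suc i → j ≡ j′
    setLast-succ-unique j< j′< e e′ with m<1+n⇒m<n∨m≡n j< | m<1+n⇒m<n∨m≡n j′<
    ... | inj₂ j≡   | inj₂ j′≡   = trans j≡ (sym j′≡)
    ... | inj₂ refl | inj₁ j′<1+k =
      ⊥-elim (noSuccessorOfLast j′<1+k (trans (sym (below j′<1+k)) (trans e′ (cong suc (lastPred e)))))
    ... | inj₁ j<1+k | inj₂ refl =
      ⊥-elim (noSuccessorOfLast j<1+k (trans (sym (below j<1+k)) (trans e (cong suc (lastPred e′)))))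
    ... | inj₁ j<1+k | inj₁ j′<1+k =
      succ-unique P j<1+k j′<1+k (trans (sym (below j<1+k)) e) (trans (sym (below j′<1+k)) e′)

    setLast-noDistantCrossing : ∀ {j₁ j₂ a b} → j₂ < suc (suc k) → g j₁ ≡ suc a → g j₂ ≡ suc b →
                         a < b → b < j₁ → j₁ < j₂ → j₁ ≤ suc b
    setLast-noDistantCrossing j₂< e e′ a<b b<j₁ j₁<j₂ with m<1+n⇒m<n∨m≡n j₂<
    ... | inj₂ refl =
      ⊥-elim (<-irrefl refl (<-≤-trans (subst (_< _) (lastPred e′) b<j₁) (m<1+n⇒m≤n j₁<j₂)))
    ... | inj₁ j₂<1+k =
      noDistantCrossing P j₂<1+k (trans (sym (below (<-trans j₁<j₂ j₂<1+k))) e)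
        (trans (sym (below j₂<1+k)) e′) a<b b<j₁ j₁<j₂

  -- An edge to the new last element could only be the right edge of a crossing,
  -- and the edge (k , suc k) leaves no room for one.
  IsPredMap-setLast : ∀ {k f} x → x ≡ 0 ⊎ x ≡ suc k → IsPredMap (suc k) f →
                      IsPredMap (suc (suc k)) (setAt (suc k) x f)
  IsPredMap-setLast x x∈ P = record
    { pred< = setLast-pred< ; succ-unique = setLast-succ-unique ; noDistantCrossing = setLast-noDistantCrossing }
    where open SetLastIsPredMap x x∈ P

  record PredVec (n : ℕ) : Set where
    constructor mkPredVec
    field
      entries    : Vec ℕ n
      .isPredMap : IsPredMap n (lookupOr 0 entries)
  open PredVec public

  ⟦_⟧ : ∀ {n} → PredVec n → ℕ → ℕ
  ⟦ p ⟧ = lookupOr 0 (entries p)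

  fromPredMap : ∀ n (π : ℕ → ℕ) → .(IsPredMap n π) → PredVec n
  fromPredMap n π P =
    mkPredVec (tabulateℕ n π) (IsPredMap-cong (λ j<n → sym (lookupOr-tabulateℕ 0 n π j<n)) P)

  PredVec-ext : ∀ {n} {p q : PredVec n} → (∀ {j} → j < n → ⟦ p ⟧ j ≡ ⟦ q ⟧ j) → p ≡ q
  PredVec-ext {p = mkPredVec u _} {mkPredVec v _} eq with lookupOr-ext 0 u v eq
  ... | refl = refl

  dropLast : ∀ {k} → PredVec (suc k) → PredVec k
  dropLast {k} (mkPredVec v P) = fromPredMap k (lookupOr 0 v) (IsPredMap-restrict (n≤1+n k) P)

  ⟦dropLast⟧ : ∀ {k} (p : PredVec (suc k)) {j} → j < k → ⟦ dropLast p ⟧ j ≡ ⟦ p ⟧ j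
  ⟦dropLast⟧ {k} (mkPredVec v P) = lookupOr-tabulateℕ 0 k (lookupOr 0 v)

  append : ∀ {k} x → x ≡ 0 ⊎ x ≡ suc k → PredVec (suc k) → PredVec (suc (suc k))
  append {k} x x∈ (mkPredVec v P) =
    fromPredMap (suc (suc k)) (setAt (suc k) x (lookupOr 0 v)) (IsPredMap-setLast x x∈ P)

  ⟦append⟧ : ∀ {k} x x∈ (q : PredVec (suc k)) {j} → j < suc (suc k) →
             ⟦ append x x∈ q ⟧ j ≡ setAt (suc k) x ⟦ q ⟧ j
  ⟦append⟧ {k} x x∈ (mkPredVec v P) = lookupOr-tabulateℕ 0 (suc (suc k)) (setAt (suc k) x (lookupOr 0 v))

  ⟦append⟧-last : ∀ {k} x x∈ (q : PredVec (suc k)) → ⟦ append x x∈ q ⟧ (suc k) ≡ x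
  ⟦append⟧-last {k} x x∈ q = trans (⟦append⟧ x x∈ q ≤-refl) (setAt-here (suc k) x ⟦ q ⟧)

  dropLast-append : ∀ {k} x x∈ (q : PredVec (suc k)) → dropLast (append x x∈ q) ≡ q
  dropLast-append {k} x x∈ q = PredVec-ext λ j<1+k →
    trans (⟦dropLast⟧ (append x x∈ q) j<1+k)
      (trans (⟦append⟧ x x∈ q (m≤n⇒m≤1+n j<1+k)) (setAt-there x ⟦ q ⟧ (λ j≡ → <-irrefl j≡ j<1+k)))

  append-dropLast : ∀ {k} x x∈ (p : PredVec (suc (suc k))) → ⟦ p ⟧ (suc k) ≡ x →
                    append x x∈ (dropLast p) ≡ p
  append-dropLast {k} x x∈ p last≡ =
    PredVec-ext λ j< → trans (⟦append⟧ x x∈ (dropLast p) j<) (agree j<)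
    where
    agree : ∀ {j} → j < suc (suc k) → setAt (suc k) x ⟦ dropLast p ⟧ j ≡ ⟦ p ⟧ j
    agree {j} j< with j ≟ suc k
    ... | yes refl = sym last≡
    ... | no  j≢   = ⟦dropLast⟧ p (≤∧≢⇒< (m<1+n⇒m≤n j<) j≢)

  record Unlinked (m : ℕ) : Set where
    constructor mkUnlinked
    field
      whole     : PredVec (suc (suc m))
      .unlinked : ⟦ whole ⟧ (suc m) ≢ suc m
  open Unlinked public

  Unlinked-≡ : ∀ {m} {u v : Unlinked m} → whole u ≡ whole v → u ≡ v
  Unlinked-≡ {u = mkUnlinked p _} {mkUnlinked .p _} refl = refl

  PredVec↔Unlinked⊎PredVec : ∀ n → PredVec (suc (suc n)) ↔ (Unlinked n ⊎ PredVec (suc n))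
  PredVec↔Unlinked⊎PredVec n = mk↔ₛ′ to from to∘from from∘to
    where
    link : PredVec (suc n) → PredVec (suc (suc n))
    link = append (suc n) (inj₂ refl)

    split : (p : PredVec (suc (suc n))) → Dec (⟦ p ⟧ (suc n) ≡ suc n) → Unlinked n ⊎ PredVec (suc n)
    split p (yes _)      = inj₂ (dropLast p)
    split p (no ¬linked) = inj₁ (mkUnlinked p ¬linked)

    to : PredVec (suc (suc n)) → Unlinked n ⊎ PredVec (suc n)
    to p = split p (⟦ p ⟧ (suc n) ≟ suc n)

    from : Unlinked n ⊎ PredVec (suc n) → PredVec (suc (suc n))
    from (inj₁ u) = whole u
    from (inj₂ q) = link q

    to∘from : ∀ y → to (from y) ≡ y
    to∘from (inj₁ (mkUnlinked p ¬linked)) with ⟦ p ⟧ (suc n) ≟ suc n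
    ... | yes linked = Irrelevant.⊥-elim (¬linked linked)
    ... | no  _      = refl
    to∘from (inj₂ q) with ⟦ link q ⟧ (suc n) ≟ suc n
    ... | yes _       = cong inj₂ (dropLast-append (suc n) (inj₂ refl) q)
    ... | no  ¬linked = ⊥-elim (¬linked (⟦append⟧-last (suc n) (inj₂ refl) q))

    from∘to : ∀ p → from (to p) ≡ p
    from∘to p with ⟦ p ⟧ (suc n) ≟ suc n
    ... | yes linked = append-dropLast (suc n) (inj₂ refl) p linked
    ... | no  _      = refl

  -- Grafting a partition under an edge

  1+m+k≤n⇒k<n∸m : ∀ m k n → suc m + k ≤ n → k < n ∸ m
  1+m+k≤n⇒k<n∸m m k n le = m+n≤o⇒m≤o∸n (suc k) (subst (_≤ n) (cong suc (+-comm m k)) le)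

  k<n∸m⇒1+m+k≤n : ∀ m k n → k < n ∸ m → suc m + k ≤ n
  k<n∸m⇒1+m+k≤n zero    k (suc n) k<n   = k<n
  k<n∸m⇒1+m+k≤n (suc m) k (suc n) k<n∸m = s≤s (k<n∸m⇒1+m+k≤n m k n k<n∸m)

  m∸n≡1+o⇒m≡1+o+n : ∀ m n o → m ∸ n ≡ suc o → m ≡ suc (o + n)
  m∸n≡1+o⇒m≡1+o+n m       zero    o eq = trans eq (cong suc (sym (+-identityʳ o)))
  m∸n≡1+o⇒m≡1+o+n (suc m) (suc n) o eq = cong suc (trans (m∸n≡1+o⇒m≡1+o+n m n o eq) (sym (+-suc o n)))

  shiftPred : ℕ → ℕ → ℕ
  shiftPred c zero    = zero
  shiftPred c (suc t) = suc (t + c)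

  shiftPred≡suc⁻¹ : ∀ c x {t} → shiftPred c x ≡ suc t → Σ ℕ λ t′ → x ≡ suc t′ × t ≡ t′ + c
  shiftPred≡suc⁻¹ c (suc x) refl = x , refl , refl

  -- A partition of [n + 2] in which n + 1 follows m: A on [0 , m + 1] and B on
  -- [m + 1 , n], with position k of B placed at m + 1 + k; the two share m + 1.
  graft : ℕ → ℕ → (ℕ → ℕ) → (ℕ → ℕ) → ℕ → ℕ
  graft n m A B j with j ≤? suc m
  ... | yes _ = A j
  ... | no  _ with j ≤? n
  ...   | yes _ = shiftPred (suc m) (B (j ∸ suc m))
  ...   | no  _ = suc m

  inner : ℕ → (ℕ → ℕ) → ℕ → ℕ
  inner m π k = π (suc m + k) ∸ suc m

  data Region (n m j : ℕ) : Set where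
    outer  : j ≤ suc m → Region n m j
    nested : ∀ k → 0 < k → suc m + k ≤ n → j ≡ suc m + k → Region n m j
    last   : j ≡ suc n → Region n m j

  region : ∀ n m {j} → j < suc (suc n) → Region n m j
  region n m {j} j<2+n with j ≤? suc m
  ... | yes j≤1+m = outer j≤1+m
  ... | no  j≰1+m with j ≤? n
  ...   | yes j≤n = nested (j ∸ suc m) (m<n⇒0<n∸m (≰⇒> j≰1+m)) (subst (_≤ n) (sym j≡) j≤n) (sym j≡)
    where j≡ = m+[n∸m]≡n (<⇒≤ (≰⇒> j≰1+m))
  ...   | no  j≰n = last (≤-antisym (m<1+n⇒m≤n j<2+n) (≰⇒> j≰n))

  module _ (n m : ℕ) (A B : ℕ → ℕ) where

    graft-outer : ∀ {j} → j ≤ suc m → graft n m A B j ≡ A j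
    graft-outer {j} j≤1+m with j ≤? suc m
    ... | yes _   = refl
    ... | no  j≰ = ⊥-elim (j≰ j≤1+m)

    graft-nested : ∀ {k} → 0 < k → suc m + k ≤ n → graft n m A B (suc m + k) ≡ shiftPred (suc m) (B k)
    graft-nested {k} 0<k le with suc m + k ≤? suc m
    ... | yes le′ = ⊥-elim (<-irrefl refl (<-≤-trans (m<m+n (suc m) 0<k) le′))
    ... | no  _ with suc m + k ≤? n
    ...   | yes _  = cong (λ i → shiftPred (suc m) (B i)) (m+n∸m≡n (suc m) k)
    ...   | no  ≰n = ⊥-elim (≰n le)

    graft-last : m < n → graft n m A B (suc n) ≡ suc m
    graft-last m<n with suc n ≤? suc m
    ... | yes le = ⊥-elim (<-irrefl refl (<-≤-trans (s≤s m<n) le))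
    ... | no  _ with suc n ≤? n
    ...   | yes le = ⊥-elim (<-irrefl refl le)
    ...   | no  _  = refl

  module GraftIsPredMap (n m : ℕ) (A B : ℕ → ℕ) (m<n : m < n)
    (PA : IsPredMap (suc (suc m)) A) (A-unlinked : A (suc m) ≢ suc m) (PB : IsPredMap (n ∸ m) B) where

    private
      g : ℕ → ℕ
      g = graft n m A B

      outerPred : ∀ {j t} → j ≤ suc m → g j ≡ suc t → A j ≡ suc t
      outerPred j≤ e = trans (sym (graft-outer n m A B j≤)) e

      nestedPred : ∀ {k t} → 0 < k → suc m + k ≤ n → g (suc m + k) ≡ suc t →
                   Σ ℕ λ t′ → B k ≡ suc t′ × t ≡ t′ + suc m
      nestedPred 0<k le e = shiftPred≡suc⁻¹ (suc m) _ (trans (sym (graft-nested n m A B 0<k le)) e)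

      lastPred : ∀ {t} → g (suc n) ≡ suc t → t ≡ m
      lastPred e = suc-injective (trans (sym e) (graft-last n m A B m<n))

      outerPred< : ∀ {j t} → j ≤ suc m → g j ≡ suc t → t < j
      outerPred< j≤ e = pred< PA (s≤s j≤) (outerPred j≤ e)

      outer-nested : ∀ {j i k} → j ≤ suc m → g j ≡ suc i →
                     0 < k → suc m + k ≤ n → g (suc m + k) ≢ suc i
      outer-nested j≤ e 0<k le e′ with nestedPred 0<k le e′
      ... | t′ , _ , refl = <-irrefl refl (<-≤-trans (outerPred< j≤ e) (≤-trans j≤ (m≤n+m (suc m) t′)))

      outer-last : ∀ {j i} → j ≤ suc m → g j ≡ suc i → g (suc n) ≢ suc i
      outer-last {j} j≤ e e′ with lastPred e′
      ... | refl =
        A-unlinked (subst (λ z → A z ≡ suc m) (≤-antisym j≤ (outerPred< j≤ e)) (outerPred j≤ e))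

      nested-last : ∀ {i k} → 0 < k → suc m + k ≤ n → g (suc m + k) ≡ suc i → g (suc n) ≢ suc i
      nested-last 0<k le e e′ with nestedPred 0<k le e
      ... | t′ , _ , refl = <-irrefl (sym (lastPred e′)) (<-≤-trans (n<1+n m) (m≤n+m (suc m) t′))

    graft-pred< : ∀ {j t} → j < suc (suc n) → g j ≡ suc t → t < j
    graft-pred< j< e with region n m j<
    ... | outer j≤ = outerPred< j≤ e
    ... | nested k 0<k le refl with nestedPred 0<k le e
    ...   | t′ , e′ , refl =
      subst (t′ + suc m <_) (+-comm k (suc m)) (+-monoˡ-< (suc m) (pred< PB (1+m+k≤n⇒k<n∸m m k n le) e′))
    graft-pred< j< e | last refl = subst (_< suc n) (sym (lastPred e)) (s≤s (<⇒≤ m<n))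

    graft-succ-unique : ∀ {j j′ i} → j < suc (suc n) → j′ < suc (suc n) →
                        g j ≡ suc i → g j′ ≡ suc i → j ≡ j′
    graft-succ-unique j< j′< e e′ with region n m j< | region n m j′<
    ... | outer j≤   | outer j′≤   =
      succ-unique PA (s≤s j≤) (s≤s j′≤) (outerPred j≤ e) (outerPred j′≤ e′)
    ... | outer j≤   | nested _ 0<k le refl = ⊥-elim (outer-nested j≤ e 0<k le e′)
    ... | nested _ 0<k le refl | outer j′≤ = ⊥-elim (outer-nested j′≤ e′ 0<k le e)
    ... | outer j≤   | last refl   = ⊥-elim (outer-last j≤ e e′)
    ... | last refl  | outer j′≤   = ⊥-elim (outer-last j′≤ e′ e)
    ... | nested _ 0<k le refl | last refl = ⊥-elim (nested-last 0<k le e e′)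
    ... | last refl  | nested _ 0<k le refl = ⊥-elim (nested-last 0<k le e′ e)
    ... | last j≡    | last j′≡    = trans j≡ (sym j′≡)
    ... | nested k 0<k le refl | nested k′ 0<k′ le′ refl with nestedPred 0<k le e | nestedPred 0<k′ le′ e′
    ...   | t , eB , t≡ | t′ , eB′ , t′≡ =
      cong (suc m +_) (succ-unique PB (1+m+k≤n⇒k<n∸m m k n le) (1+m+k≤n⇒k<n∸m m k′ n le′) eB
        (trans eB′ (cong suc (+-cancelʳ-≡ (suc m) t′ t (trans (sym t′≡) t≡)))))

    graft-noDistantCrossing : ∀ {j₁ j₂ a b} → j₂ < suc (suc n) → g j₁ ≡ suc a → g j₂ ≡ suc b →
                              a < b → b < j₁ → j₁ < j₂ → j₁ ≤ suc b
    graft-noDistantCrossing j₂< e e′ a<b b<j₁ j₁<j₂ with region n m j₂<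
    ... | outer j₂≤ =
      noDistantCrossing PA (s≤s j₂≤) (outerPred (≤-trans (<⇒≤ j₁<j₂) j₂≤) e) (outerPred j₂≤ e′)
        a<b b<j₁ j₁<j₂
    ... | nested k₂ 0<k₂ le₂ refl with nestedPred 0<k₂ le₂ e′ | region n m (<-trans j₁<j₂ j₂<)
    ...   | t₂ , _ , refl | outer j₁≤ =
      ⊥-elim (<-irrefl refl (<-≤-trans b<j₁ (≤-trans j₁≤ (m≤n+m (suc m) t₂))))
    ...   | t₂ , _ , refl | last refl = ⊥-elim (<-irrefl refl (<-trans j₁<j₂ (s≤s le₂)))
    ...   | t₂ , e₂ , refl | nested k₁ 0<k₁ le₁ refl with nestedPred 0<k₁ le₁ e
    ...     | t₁ , e₁ , refl =
      let inside = noDistantCrossing PB (1+m+k≤n⇒k<n∸m m k₂ n le₂) e₁ e₂ (+-cancelʳ-< (suc m) t₁ t₂ a<b)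
                     (+-cancelˡ-< (suc m) t₂ k₁ (subst (_< suc m + k₁) (+-comm t₂ (suc m)) b<j₁))
                     (+-cancelˡ-< (suc m) k₁ k₂ j₁<j₂)
      in subst (suc m + k₁ ≤_) (trans (+-suc (suc m) t₂) (cong suc (+-comm (suc m) t₂)))
           (+-monoʳ-≤ (suc m) inside)
    graft-noDistantCrossing j₂< e e′ a<b b<j₁ j₁<j₂ | last refl
      with lastPred e′ | region n m (<-trans j₁<j₂ j₂<)
    ... | refl | outer j₁≤ = j₁≤
    ... | refl | last refl = ⊥-elim (<-irrefl refl j₁<j₂)
    ... | refl | nested k₁ 0<k₁ le₁ refl with nestedPred 0<k₁ le₁ e
    ...   | t₁ , _ , refl = ⊥-elim (<-irrefl refl (<-trans a<b (<-≤-trans (n<1+n m) (m≤n+m (suc m) t₁))))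

  IsPredMap-graft : ∀ {n m A B} → m < n → IsPredMap (suc (suc m)) A → A (suc m) ≢ suc m →
                    IsPredMap (n ∸ m) B → IsPredMap (suc (suc n)) (graft n m A B)
  IsPredMap-graft {n} {m} {A} {B} m<n PA A-unlinked PB = record
    { pred< = graft-pred< ; succ-unique = graft-succ-unique ; noDistantCrossing = graft-noDistantCrossing }
    where open GraftIsPredMap n m A B m<n PA A-unlinked PB

  module Cut (n m : ℕ) (π : ℕ → ℕ) (m<n : m < n)
    (P : IsPredMap (suc (suc n)) π) (last≡ : π (suc n) ≡ suc m) where

    private
      ψ : ℕ → ℕ
      ψ = inner m π

      inRange : ∀ {k} → suc m + k ≤ n → suc m + k < suc (suc n)
      inRange le = s≤s (m≤n⇒m≤1+n le)

      innerPred : ∀ {k y} → ψ k ≡ suc y → π (suc m + k) ≡ suc (y + suc m)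
      innerPred {k} {y} = m∸n≡1+o⇒m≡1+o+n (π (suc m + k)) (suc m) y

    outer-unlinked : π (suc m) ≢ suc m
    outer-unlinked e = <-irrefl (suc-injective (succ-unique P (s≤s (s≤s (<⇒≤ m<n))) ≤-refl e last≡)) m<n

    -- m already has the successor n + 1, and an edge from below m would cross
    -- (m , n + 1) at distance ≥ 2.
    nestedPred≥ : ∀ {k t} → 0 < k → suc m + k ≤ n → π (suc m + k) ≡ suc t → suc m ≤ t
    nestedPred≥ {k} {t} 0<k le e with <-cmp t m
    ... | tri> _ _ m<t = m<t
    ... | tri≈ _ refl _ =
      ⊥-elim (<-irrefl refl
        (<-≤-trans (s≤s le) (≤-reflexive (sym (succ-unique P (inRange le) ≤-refl e last≡)))))
    ... | tri< t<m _ _ =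
      ⊥-elim (<-irrefl refl (<-≤-trans (m<m+n (suc m) 0<k)
        (noDistantCrossing P ≤-refl e last≡ t<m (m≤m+n (suc m) k) (s≤s le))))

    IsPredMap-inner : IsPredMap (n ∸ m) ψ
    IsPredMap-inner = record
      { pred< = pred<′ ; succ-unique = succ-unique′ ; noDistantCrossing = noDistantCrossing′ }
      where
      at : ∀ {k} → k < n ∸ m → suc m + k < suc (suc n)
      at k< = inRange (k<n∸m⇒1+m+k≤n m _ n k<)

      pred<′ : ∀ {k t} → k < n ∸ m → ψ k ≡ suc t → t < k
      pred<′ {k} {t} k< e =
        +-cancelʳ-< (suc m) t k (subst (t + suc m <_) (+-comm (suc m) k) (pred< P (at k<) (innerPred e)))

      succ-unique′ : ∀ {k k′ i} → k < n ∸ m → k′ < n ∸ m →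
                     ψ k ≡ suc i → ψ k′ ≡ suc i → k ≡ k′
      succ-unique′ {k} {k′} k< k′< e e′ =
        +-cancelˡ-≡ (suc m) k k′ (succ-unique P (at k<) (at k′<) (innerPred e) (innerPred e′))

      noDistantCrossing′ : ∀ {k₁ k₂ a b} → k₂ < n ∸ m → ψ k₁ ≡ suc a → ψ k₂ ≡ suc b →
                           a < b → b < k₁ → k₁ < k₂ → k₁ ≤ suc b
      noDistantCrossing′ {k₁} {k₂} {a} {b} k₂< e e′ a<b b<k₁ k₁<k₂ =
        +-cancelˡ-≤ (suc m) k₁ (suc b)
          (subst (suc m + k₁ ≤_) (sym (trans (+-suc (suc m) b) (cong suc (+-comm (suc m) b))))
            (noDistantCrossing P (at k₂<) (innerPred e) (innerPred e′) (+-monoˡ-< (suc m) a<b)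
              (subst (b + suc m <_) (+-comm k₁ (suc m)) (+-monoˡ-< (suc m) b<k₁))
              (+-monoʳ-< (suc m) k₁<k₂)))

    shiftPred-inner : ∀ {k} → 0 < k → suc m + k ≤ n → shiftPred (suc m) (ψ k) ≡ π (suc m + k)
    shiftPred-inner {k} 0<k le with π (suc m + k) in eq
    ... | zero  = refl
    ... | suc t with nestedPred≥ 0<k le eq
    ...   | s≤s {n = t′} m≤t′ =
      trans (cong (shiftPred (suc m)) (+-∸-assoc 1 m≤t′))
            (cong suc (trans (+-suc (t′ ∸ m) m) (cong suc (m∸n+n≡m m≤t′))))

    graft-cut : ∀ {A B} → (∀ {j} → j < suc (suc m) → A j ≡ π j) →
                (∀ {k} → k < n ∸ m → B k ≡ ψ k) →
                ∀ {j} → j < suc (suc n) → graft n m A B j ≡ π j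
    graft-cut {A} {B} A≗π B≗ψ j< with region n m j<
    ... | outer j≤ = trans (graft-outer n m A B j≤) (A≗π (s≤s j≤))
    ... | nested k 0<k le refl =
      trans (graft-nested n m A B 0<k le) (trans (cong (shiftPred (suc m)) (B≗ψ (1+m+k≤n⇒k<n∸m m k n le)))
        (shiftPred-inner 0<k le))
    ... | last refl = trans (graft-last n m A B m<n) (sym last≡)

  inner-graft : ∀ n m {A B} → IsPredMap (suc (suc m)) A → IsPredMap (n ∸ m) B →
                ∀ {k} → k < n ∸ m → inner m (graft n m A B) k ≡ B k
  inner-graft n m {A} {B} PA PB {zero} 0<n∸m =
    trans (cong (_∸ suc m) (graft-outer n m A B 1+m+0≤1+m))
      (trans (m≤n⇒m∸n≡0 (≤-trans (pred≤ PA (s≤s 1+m+0≤1+m)) 1+m+0≤1+m)) (sym (pred-0≡0 PB 0<n∸m)))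
    where 1+m+0≤1+m = ≤-reflexive (+-identityʳ (suc m))
  inner-graft n m {A} {B} PA PB {suc k} k< =
    trans (cong (_∸ suc m) (graft-nested n m A B z<s (k<n∸m⇒1+m+k≤n m (suc k) n k<))) (shift-back (B (suc k)))
    where
    shift-back : ∀ x → shiftPred (suc m) x ∸ suc m ≡ x
    shift-back zero    = 0∸n≡0 (suc m)
    shift-back (suc t) = m+n∸n≡m (suc t) (suc m)

  Nested : ℕ → Set
  Nested n = Σ (Fin n) λ m → Unlinked (toℕ m) × PredVec (n ∸ toℕ m)

  module NestedDecomposition (n : ℕ) where

    graftWhole : Nested n → PredVec (suc (suc n))
    graftWhole (m , mkUnlinked (mkPredVec a PA) ¬linkedA , mkPredVec b PB) =
      fromPredMap (suc (suc n)) (graft n (toℕ m) (lookupOr 0 a) (lookupOr 0 b))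
        (IsPredMap-graft (toℕ<n m) PA ¬linkedA PB)

    ⟦graftWhole⟧-last : ∀ t → ⟦ graftWhole t ⟧ (suc n) ≡ suc (toℕ (proj₁ t))
    ⟦graftWhole⟧-last (m , mkUnlinked (mkPredVec a _) _ , mkPredVec b _) =
      trans (lookupOr-tabulateℕ 0 (suc (suc n)) (graft n (toℕ m) (lookupOr 0 a) (lookupOr 0 b)) ≤-refl)
            (graft-last n (toℕ m) (lookupOr 0 a) (lookupOr 0 b) (toℕ<n m))

    graftNested : Nested n → Unlinked n
    graftNested t = mkUnlinked (graftWhole t) λ linked →
      <-irrefl (suc-injective (trans (sym (⟦graftWhole⟧-last t)) linked)) (toℕ<n (proj₁ t))

    cutNested : (p : PredVec (suc (suc n))) (m : Fin n) → .(⟦ p ⟧ (suc n) ≡ suc (toℕ m)) → Nested n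
    cutNested (mkPredVec v P) m last≡ =
      m , mkUnlinked (fromPredMap (suc (suc (toℕ m))) π (IsPredMap-restrict (s≤s (s≤s (<⇒≤ (toℕ<n m)))) P))
            (λ linked → Cut.outer-unlinked n (toℕ m) π (toℕ<n m) P last≡
               (trans (sym (lookupOr-tabulateℕ 0 (suc (suc (toℕ m))) π ≤-refl)) linked))
        , fromPredMap (n ∸ toℕ m) (inner (toℕ m) π) (Cut.IsPredMap-inner n (toℕ m) π (toℕ<n m) P last≡)
      where π = lookupOr 0 v

    -- The hypotheses are irrelevant, so the bound is rebuilt by its decision procedure.
    lastIndex : (u : Unlinked n) → ∀ {y} → ⟦ whole u ⟧ (suc n) ≡ suc y → Fin n
    lastIndex (mkUnlinked (mkPredVec v P) ¬linked) {y} e = fromℕ< (recompute (y <? n)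
      (≤∧≢⇒< (m<1+n⇒m≤n (pred< P ≤-refl e)) λ y≡n → ¬linked (trans e (cong suc y≡n))))

    ⟦⟧-lastIndex : (u : Unlinked n) → ∀ {y} (e : ⟦ whole u ⟧ (suc n) ≡ suc y) →
                   ⟦ whole u ⟧ (suc n) ≡ suc (toℕ (lastIndex u e))
    ⟦⟧-lastIndex (mkUnlinked (mkPredVec v P) ¬linked) e = trans e (cong suc (sym (toℕ-fromℕ< _)))

    classify : (u : Unlinked n) → ∀ x → ⟦ whole u ⟧ (suc n) ≡ x → PredVec (suc n) ⊎ Nested n
    classify u zero    _ = inj₁ (dropLast (whole u))
    classify u (suc y) e = inj₂ (cutNested (whole u) (lastIndex u e) (⟦⟧-lastIndex u e))

    from : PredVec (suc n) ⊎ Nested n → Unlinked n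
    from (inj₁ q) = mkUnlinked (append 0 (inj₁ refl) q) λ linked →
      0≢1+n (trans (sym (⟦append⟧-last 0 (inj₁ refl) q)) linked)
    from (inj₂ t) = graftNested t

    to : Unlinked n → PredVec (suc n) ⊎ Nested n
    to u = classify u _ refl

    from∘classify : ∀ u x (e : ⟦ whole u ⟧ (suc n) ≡ x) → from (classify u x e) ≡ u
    from∘classify u zero e = Unlinked-≡ (append-dropLast 0 (inj₁ refl) (whole u) e)
    from∘classify u@(mkUnlinked (mkPredVec v P) _) (suc y) e = Unlinked-≡ (PredVec-ext λ j< →
      trans (lookupOr-tabulateℕ 0 (suc (suc n)) (graft n m A B) j<) (recompute (_ ≟ _)
        (Cut.graft-cut n m π (toℕ<n (lastIndex u e)) P (⟦⟧-lastIndex u e)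
          (lookupOr-tabulateℕ 0 (suc (suc m)) π) (lookupOr-tabulateℕ 0 (n ∸ m) (inner m π)) j<)))
      where
      π = lookupOr 0 v
      m = toℕ (lastIndex u e)
      A = lookupOr 0 (tabulateℕ (suc (suc m)) π)
      B = lookupOr 0 (tabulateℕ (n ∸ m) (inner m π))

    cutNested-graftNested : ∀ t m′ → m′ ≡ proj₁ t →
                            .(e : ⟦ graftWhole t ⟧ (suc n) ≡ suc (toℕ m′)) → cutNested (graftWhole t) m′ e ≡ t
    cutNested-graftNested (m , mkUnlinked (mkPredVec a PA) _ , mkPredVec b PB) .m refl e =
      cong₂ (λ A B → m , A , B) (Unlinked-≡ (PredVec-ext outer≡)) (PredVec-ext inner≡)
      where
      m<n = toℕ<n m
      g = graft n (toℕ m) (lookupOr 0 a) (lookupOr 0 b)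
      π = lookupOr 0 (tabulateℕ (suc (suc n)) g)
      ⟦g⟧ : ∀ {j} → j < suc (suc n) → π j ≡ g j
      ⟦g⟧ = lookupOr-tabulateℕ 0 (suc (suc n)) g
      outer≡ : ∀ {j} → j < suc (suc (toℕ m)) →
               lookupOr 0 (tabulateℕ (suc (suc (toℕ m))) π) j ≡ lookupOr 0 a j
      outer≡ j< = trans (lookupOr-tabulateℕ 0 (suc (suc (toℕ m))) π j<)
        (trans (⟦g⟧ (<-≤-trans j< (s≤s (s≤s (<⇒≤ m<n)))))
               (graft-outer n (toℕ m) (lookupOr 0 a) (lookupOr 0 b) (m<1+n⇒m≤n j<)))
      inner≡ : ∀ {k} → k < n ∸ toℕ m →
               lookupOr 0 (tabulateℕ (n ∸ toℕ m) (inner (toℕ m) π)) k ≡ lookupOr 0 b k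
      inner≡ {k} k< = trans (lookupOr-tabulateℕ 0 (n ∸ toℕ m) (inner (toℕ m) π) k<)
        (trans (cong (_∸ suc (toℕ m)) (⟦g⟧ (s≤s (m≤n⇒m≤1+n (k<n∸m⇒1+m+k≤n (toℕ m) k n k<)))))
          (recompute (_ ≟ _) (inner-graft n (toℕ m) PA PB k<)))

    classify∘from : ∀ y x (e : ⟦ whole (from y) ⟧ (suc n) ≡ x) → classify (from y) x e ≡ y
    classify∘from (inj₁ q) zero    _ = cong inj₁ (dropLast-append 0 (inj₁ refl) q)
    classify∘from (inj₁ q) (suc _) e = ⊥-elim (0≢1+n (trans (sym (⟦append⟧-last 0 (inj₁ refl) q)) e))
    classify∘from (inj₂ t) zero    e = ⊥-elim (0≢1+n (trans (sym e) (⟦graftWhole⟧-last t)))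
    classify∘from (inj₂ t) (suc _) e = cong inj₂ (cutNested-graftNested t (lastIndex (graftNested t) e)
      (toℕ-injective (suc-injective (trans (sym (⟦⟧-lastIndex (graftNested t) e)) (⟦graftWhole⟧-last t))))
      (⟦⟧-lastIndex (graftNested t) e))

    Unlinked↔PredVec⊎Nested : Unlinked n ↔ (PredVec (suc n) ⊎ Nested n)
    Unlinked↔PredVec⊎Nested =
      mk↔ₛ′ to from (λ y → classify∘from y _ refl) (λ u → from∘classify u _ refl)

  -- Block minima

  onPred : ∀ {A : Set} → A → (ℕ → A) → ℕ → A
  onPred z s zero    = z
  onPred z s (suc t) = s t

  blockMinWithin : ℕ → (ℕ → ℕ) → ℕ → ℕ
  blockMinWithin zero    π i = i
  blockMinWithin (suc f) π i = onPred i (blockMinWithin f π) (π i)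

  -- The fuel suc i suffices, since predecessors decrease.
  blockMin : (ℕ → ℕ) → ℕ → ℕ
  blockMin π i = blockMinWithin (suc i) π i

  data Chain (π : ℕ → ℕ) (s : ℕ) : ℕ → Set where
    direct : ∀ {j}   → π j ≡ suc s → Chain π s j
    via    : ∀ {j t} → π j ≡ suc t → Chain π s t → Chain π s j

  module BlockMin {n : ℕ} {π : ℕ → ℕ} (P : IsPredMap n π) where

    blockMinWithin-fuel : ∀ f f′ {i} → i < f → i < f′ → i < n →
                          blockMinWithin f π i ≡ blockMinWithin f′ π i
    blockMinWithin-fuel (suc f) (suc f′) {i} i<f i<f′ i<n with π i in e
    ... | zero  = refl
    ... | suc t =
      blockMinWithin-fuel f f′ (≤-trans t<i (m<1+n⇒m≤n i<f)) (≤-trans t<i (m<1+n⇒m≤n i<f′)) (<-trans t<i i<n)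
      where t<i = pred< P i<n e

    blockMin-start : ∀ {i} → π i ≡ 0 → blockMin π i ≡ i
    blockMin-start {i} e with π i
    ... | zero = refl

    blockMin-pred : ∀ {i t} → i < n → π i ≡ suc t → blockMin π i ≡ blockMin π t
    blockMin-pred {i} {t} i<n e rewrite e = blockMinWithin-fuel i (suc t) t<i ≤-refl (<-trans t<i i<n)
      where t<i = pred< P i<n e

    blockMin-cong : ∀ {ψ} → (∀ {j} → j < n → ψ j ≡ π j) →
                    ∀ {i} → i < n → blockMin ψ i ≡ blockMin π i
    blockMin-cong {ψ} ψ≗π {i} = go (suc i)
      where
      go : ∀ f {i} → i < n → blockMinWithin f ψ i ≡ blockMinWithin f π i
      go zero    _   = refl
      go (suc f) {i} i<n rewrite ψ≗π i<n = byPred (π i) refl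
        where
        byPred : ∀ x → π i ≡ x → onPred i (blockMinWithin f ψ) x ≡ onPred i (blockMinWithin f π) x
        byPred zero    _ = refl
        byPred (suc t) e = go f (<-trans (pred< P i<n e) i<n)

    predecessor-induction : (Q : ℕ → Set) → (∀ {i} → i < n → π i ≡ 0 → Q i) →
                            (∀ {i t} → i < n → π i ≡ suc t → Q t → Q i) → ∀ {i} → i < n → Q i
    predecessor-induction Q start step {i} = go (suc i) ≤-refl
      where
      go : ∀ b {i} → i < b → i < n → Q i
      go (suc b) {i} i<b i<n = byPred (π i) refl
        where
        byPred : ∀ x → π i ≡ x → Q i
        byPred zero    e = start i<n e
        byPred (suc t) e = step i<n e (go b (≤-trans t<i (m<1+n⇒m≤n i<b)) (<-trans t<i i<n))
          where t<i = pred< P i<n e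

    blockMin≤ : ∀ {i} → i < n → blockMin π i ≤ i
    blockMin≤ = predecessor-induction (λ i → blockMin π i ≤ i) (λ _ e → ≤-reflexive (blockMin-start e))
      λ i<n e ih → ≤-trans (≤-reflexive (blockMin-pred i<n e)) (≤-trans ih (<⇒≤ (pred< P i<n e)))

    Chain-< : ∀ {s j} → Chain π s j → j < n → s < j
    Chain-< (direct e)  j<n = pred< P j<n e
    Chain-< (via e c) j<n = <-trans (Chain-< c (<-trans t<j j<n)) t<j
      where t<j = pred< P j<n e

    Chain-≤pred : ∀ {s j q} → Chain π s j → j < n → π j ≡ suc q → s ≤ q
    Chain-≤pred (direct e)  _   e′ = ≤-reflexive (suc-injective (trans (sym e) e′))
    Chain-≤pred (via e c) j<n e′ =
      subst (_ ≤_) (suc-injective (trans (sym e) e′)) (<⇒≤ (Chain-< c (<-trans (pred< P j<n e) j<n)))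

    Chain-successor : ∀ {q s} → Chain π q s → s < n → Σ ℕ λ a → π a ≡ suc q × a ≤ s
    Chain-successor {s = s} (direct e) _ = s , e , ≤-refl
    Chain-successor (via e c) s<n with Chain-successor c (<-trans (pred< P s<n e) s<n)
    ... | a , e′ , a≤t = a , e′ , ≤-trans a≤t (<⇒≤ (pred< P s<n e))

    start-¬Chain : ∀ {s j} → π j ≡ 0 → ¬ Chain π s j
    start-¬Chain e (direct e′)  = 0≢1+n (trans (sym e) e′)
    start-¬Chain e (via e′ _) = 0≢1+n (trans (sym e) e′)

    -- Since every element has at most one successor, two chains ending at j
    -- are nested; so anything before j in j's block lies on j's chain.
    sameBlockMin⇒Chain : ∀ {s j} → s < j → j < n → blockMin π s ≡ blockMin π j → Chain π s j
    sameBlockMin⇒Chain {j = j} = go (suc j) ≤-refl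
      where
      go : ∀ b {s j} → j < b → s < j → j < n → blockMin π s ≡ blockMin π j → Chain π s j
      go (suc b) {s} {j} j<b s<j j<n same = byPred (π j) refl
        where
        byPred : ∀ x → π j ≡ x → Chain π s j
        byPred zero e =
          ⊥-elim (<⇒≱ s<j (subst (_≤ s) (trans same (blockMin-start e)) (blockMin≤ (<-trans s<j j<n))))
        byPred (suc q) e with <-cmp s q
        ... | tri≈ _ refl _ = direct e
        ... | tri< s<q _ _ =
          via e (go b (≤-trans q<j (m<1+n⇒m≤n j<b)) s<q (<-trans q<j j<n) (trans same (blockMin-pred j<n e)))
          where q<j = pred< P j<n e
        ... | tri> _ _ q<s
          with go b (≤-trans s<j (m<1+n⇒m≤n j<b)) q<s (<-trans s<j j<n)
                  (trans (sym (blockMin-pred j<n e)) (sym same))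
        ...   | c with Chain-successor c (<-trans s<j j<n)
        ...     | a , e′ , a≤s =
          ⊥-elim (<-irrefl (succ-unique P (≤-<-trans a≤s (<-trans s<j j<n)) j<n e′ e) (≤-<-trans a≤s s<j))

    standardEdge⇒pred : ∀ {i j} → i < j → j < n → blockMin π i ≡ blockMin π j →
                        (∀ {t} → i < t → t < j → blockMin π i ≢ blockMin π t) → π j ≡ suc i
    standardEdge⇒pred {i} {j} i<j j<n same nothingBetween = byPred (π j) refl
      where
      c = sameBlockMin⇒Chain i<j j<n same
      byPred : ∀ x → π j ≡ x → π j ≡ suc i
      byPred zero    e = ⊥-elim (start-¬Chain e c)
      byPred (suc q) e with m≤n⇒m<n∨m≡n (Chain-≤pred c j<n e)
      ... | inj₂ refl = e
      ... | inj₁ i<q  = ⊥-elim (nothingBetween i<q (pred< P j<n e) (trans same (blockMin-pred j<n e)))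

    pred-nothingBetween : ∀ {i j s} → j < n → π j ≡ suc i → i < s → s < j → blockMin π s ≢ blockMin π j
    pred-nothingBetween j<n e i<s s<j same = <⇒≱ i<s (Chain-≤pred (sameBlockMin⇒Chain s<j j<n same) j<n e)

    start-nothingBefore : ∀ {j s} → j < n → π j ≡ 0 → s < j → blockMin π s ≢ blockMin π j
    start-nothingBefore j<n e s<j same = start-¬Chain e (sameBlockMin⇒Chain s<j j<n same)

  lastRelated : (ℕ → ℕ → Bool) → ℕ → ℕ → ℕ
  lastRelated R j zero    = 0
  lastRelated R j (suc t) = if R t j then suc t else lastRelated R j t

  predecessorIn : (ℕ → ℕ → Bool) → ℕ → ℕ
  predecessorIn R j = lastRelated R j j

  module _ (R : ℕ → ℕ → Bool) (j : ℕ) where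

    lastRelated≡suc⁻¹ : ∀ k {t} → lastRelated R j k ≡ suc t →
                        t < k × T (R t j) × (∀ {s} → t < s → s < k → ¬ T (R s j))
    lastRelated≡suc⁻¹ (suc k) {t} e with R k j in eR
    ... | true with refl ← e = ≤-refl , subst T (sym eR) tt , λ t<s s<1+k _ → <⇒≱ t<s (m<1+n⇒m≤n s<1+k)
    ... | false with lastRelated≡suc⁻¹ k e
    ...   | t<k , Rtj , none =
      m≤n⇒m≤1+n t<k , Rtj , λ t<s s<1+k Rsj → case t<s Rsj (m<1+n⇒m<n∨m≡n s<1+k)
      where
      case : ∀ {s} → t < s → T (R s j) → s < k ⊎ s ≡ k → ⊥
      case t<s Rsj (inj₁ s<k)  = none t<s s<k Rsj
      case t<s Rsj (inj₂ refl) = subst T eR Rsj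

    lastRelated≡0⁻¹ : ∀ k → lastRelated R j k ≡ 0 → ∀ {s} → s < k → ¬ T (R s j)
    lastRelated≡0⁻¹ (suc k) e s<1+k Rsj with R k j in eR | m<1+n⇒m<n∨m≡n s<1+k
    ... | false | inj₁ s<k  = lastRelated≡0⁻¹ k e s<k Rsj
    ... | false | inj₂ refl = subst T eR Rsj

    lastRelated≡suc : ∀ k {t} → t < k → T (R t j) → (∀ {s} → t < s → s < k → ¬ T (R s j)) →
                      lastRelated R j k ≡ suc t
    lastRelated≡suc (suc k) t<1+k Rtj none with m<1+n⇒m<n∨m≡n t<1+k
    lastRelated≡suc (suc k) t<1+k Rtj none | inj₂ refl with R k j
    ... | true  = refl
    ... | false = ⊥-elim Rtj
    lastRelated≡suc (suc k) t<1+k Rtj none | inj₁ t<k with R k j in eR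
    ... | true  = ⊥-elim (none t<k ≤-refl (subst T (sym eR) tt))
    ... | false = lastRelated≡suc k t<k Rtj (λ t<s s<k → none t<s (m≤n⇒m≤1+n s<k))

    lastRelated≡0 : ∀ k → (∀ {s} → s < k → ¬ T (R s j)) → lastRelated R j k ≡ 0
    lastRelated≡0 zero    none = refl
    lastRelated≡0 (suc k) none with R k j in eR
    ... | true  = ⊥-elim (none ≤-refl (subst T (sym eR) tt))
    ... | false = lastRelated≡0 k (λ s<k → none (m≤n⇒m≤1+n s<k))

  lastRelated-cong : ∀ {R R′ j} k → (∀ {t} → t < k → R t j ≡ R′ t j) →
                     lastRelated R j k ≡ lastRelated R′ j k
  lastRelated-cong                 zero    _ = refl
  lastRelated-cong {R} {R′} {j} (suc k) R≗R′ rewrite R≗R′ ≤-refl =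
    cong (if R′ k j then suc k else_) (lastRelated-cong k (λ t<k → R≗R′ (m≤n⇒m≤1+n t<k)))

  StandardEdgeℕ : (ℕ → ℕ → Bool) → ℕ → ℕ → Set
  StandardEdgeℕ R i j = i < j × T (R i j) × (∀ {t} → i < t → t < j → ¬ T (R i t))

  record IsNoncrossingRel (n : ℕ) (R : ℕ → ℕ → Bool) : Set where
    field
      R-refl              : ∀ {i} → i < n → T (R i i)
      R-sym               : ∀ {i j} → i < n → j < n → T (R i j) → T (R j i)
      R-trans             : ∀ {i j k} → i < n → j < n → k < n → T (R i j) → T (R j k) → T (R i k)
      R-noDistantCrossing : ∀ {a j₁ b j₂} → j₂ < n → StandardEdgeℕ R a j₁ → StandardEdgeℕ R b j₂ →
                            a < b → b < j₁ → j₁ < j₂ → j₁ ≤ suc b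
  open IsNoncrossingRel public

  module FromRelation {n : ℕ} {R : ℕ → ℕ → Bool} (N : IsNoncrossingRel n R) where

    π : ℕ → ℕ
    π = predecessorIn R

    predecessorIn≡suc⁻¹ : ∀ {j t} → π j ≡ suc t →
                          t < j × T (R t j) × (∀ {s} → t < s → s < j → ¬ T (R s j))
    predecessorIn≡suc⁻¹ {j} = lastRelated≡suc⁻¹ R j j

    predecessor-standardEdge : ∀ {j a} → j < n → π j ≡ suc a → StandardEdgeℕ R a j
    predecessor-standardEdge {j} {a} j<n e with predecessorIn≡suc⁻¹ e
    ... | a<j , Raj , none = a<j , Raj , noneFromA
      where
      noneFromA : ∀ {t} → a < t → t < j → ¬ T (R a t)
      noneFromA a<t t<j Rat = none a<t t<j (R-trans N t<n a<n j<n (R-sym N a<n t<n Rat) Raj)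
        where
        t<n = <-trans t<j j<n
        a<n = <-trans a<t t<n

    private
      succ-unique< : ∀ {j j′ i} → j < j′ → j′ < n → π j ≡ suc i → π j′ ≡ suc i → ⊥
      succ-unique< j<j′ j′<n e e′ with predecessorIn≡suc⁻¹ e | predecessorIn≡suc⁻¹ e′
      ... | i<j , Rij , _ | _ , Rij′ , none′ =
        none′ i<j j<j′ (R-trans N j<n i<n j′<n (R-sym N i<n j<n Rij) Rij′)
        where
        j<n = <-trans j<j′ j′<n
        i<n = <-trans i<j j<n

    IsPredMap-predecessorIn : IsPredMap n π
    IsPredMap-predecessorIn = record
      { pred<             = λ _ e → proj₁ (predecessorIn≡suc⁻¹ e)
      ; succ-unique       = succ-unique′
      ; noDistantCrossing = λ j₂<n e e′ a<b b<j₁ j₁<j₂ → R-noDistantCrossing N j₂<n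
          (predecessor-standardEdge (<-trans j₁<j₂ j₂<n) e) (predecessor-standardEdge j₂<n e′)
          a<b b<j₁ j₁<j₂ }
      where
      succ-unique′ : ∀ {j j′ i} → j < n → j′ < n → π j ≡ suc i → π j′ ≡ suc i → j ≡ j′
      succ-unique′ {j} {j′} j<n j′<n e e′ with <-cmp j j′
      ... | tri≈ _ j≡j′ _ = j≡j′
      ... | tri< j<j′ _ _ = ⊥-elim (succ-unique< j<j′ j′<n e e′)
      ... | tri> _ _ j′<j = ⊥-elim (succ-unique< j′<j j<n e′ e)

    open BlockMin IsPredMap-predecessorIn

    related-blockMin : ∀ {i} → i < n → T (R (blockMin π i) i)
    related-blockMin = predecessor-induction (λ i → T (R (blockMin π i) i))
      (λ {i} i<n e → subst (λ z → T (R z i)) (sym (blockMin-start {i} e)) (R-refl N i<n))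
      λ {i} {t} i<n e ih → let t<i , Rti , _ = predecessorIn≡suc⁻¹ e; t<n = <-trans t<i i<n in
        subst (λ z → T (R z i)) (sym (blockMin-pred i<n e))
          (R-trans N (≤-<-trans (blockMin≤ t<n) t<n) t<n i<n ih Rti)

    blockMin-least : ∀ {i t} → i < n → t < n → T (R t i) → blockMin π i ≤ t
    blockMin-least i<n =
      predecessor-induction (λ i → ∀ {t} → t < n → T (R t i) → blockMin π i ≤ t) start step i<n
      where
      start : ∀ {i} → i < n → π i ≡ 0 → ∀ {t} → t < n → T (R t i) → blockMin π i ≤ t
      start {i} _ e {t} _ Rti with <-cmp t i
      ... | tri< t<i _ _ = ⊥-elim (lastRelated≡0⁻¹ R i i e t<i Rti)
      ... | tri≈ _ refl _ = ≤-reflexive (blockMin-start e)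
      ... | tri> _ _ i<t = ≤-trans (≤-reflexive (blockMin-start e)) (<⇒≤ i<t)
      step : ∀ {i s} → i < n → π i ≡ suc s → (∀ {t} → t < n → T (R t s) → blockMin π s ≤ t) →
             ∀ {t} → t < n → T (R t i) → blockMin π i ≤ t
      step i<n e ih t<n Rti = let s<i , Rsi , _ = predecessorIn≡suc⁻¹ e; s<n = <-trans s<i i<n in
        subst (_≤ _) (sym (blockMin-pred i<n e)) (ih t<n (R-trans N t<n i<n s<n Rti (R-sym N s<n i<n Rsi)))

    R≡sameBlockMin : ∀ {i j} → i < n → j < n → R i j ≡ (blockMin π i ≡ᵇ blockMin π j)
    R≡sameBlockMin {i} {j} i<n j<n with R i j in eR | blockMin π i ≡ᵇ blockMin π j in eS
    ... | true  | true  = refl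
    ... | false | false = refl
    ... | true  | false = ⊥-elim (subst T eS (≡⇒≡ᵇ (blockMin π i) (blockMin π j) (≤-antisym ≤j ≤i)))
      where
      Rij = subst T (sym eR) tt
      m<n : ∀ {k} → k < n → blockMin π k < n
      m<n k<n = ≤-<-trans (blockMin≤ k<n) k<n
      ≤j = blockMin-least i<n (m<n j<n) (R-trans N (m<n j<n) j<n i<n (related-blockMin j<n) (R-sym N i<n j<n Rij))
      ≤i = blockMin-least j<n (m<n i<n) (R-trans N (m<n i<n) i<n j<n (related-blockMin i<n) Rij)
    ... | false | true  = ⊥-elim (subst T eR (R-trans N i<n m<n j<n (R-sym N m<n i<n (related-blockMin i<n))
        (subst (λ z → T (R z j)) (sym same) (related-blockMin j<n))))
      where
      m<n = ≤-<-trans (blockMin≤ i<n) i<n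
      same = ≡ᵇ⇒≡ (blockMin π i) (blockMin π j) (subst T (sym eS) tt)

  sameBlock : (ℕ → ℕ) → ℕ → ℕ → Bool
  sameBlock π i j = blockMin π i ≡ᵇ blockMin π j

  module FromPredMap {n : ℕ} {π : ℕ → ℕ} (P : IsPredMap n π) where
    open BlockMin P

    private
      sameBlock⇒ : ∀ {i j} → T (sameBlock π i j) → blockMin π i ≡ blockMin π j
      sameBlock⇒ {i} {j} = ≡ᵇ⇒≡ (blockMin π i) (blockMin π j)

      ⇒sameBlock : ∀ {i j} → blockMin π i ≡ blockMin π j → T (sameBlock π i j)
      ⇒sameBlock {i} {j} = ≡⇒≡ᵇ (blockMin π i) (blockMin π j)

    predecessorIn-sameBlock : ∀ {j} → j < n → predecessorIn (sameBlock π) j ≡ π j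
    predecessorIn-sameBlock {j} j<n = byPred (π j) refl
      where
      byPred : ∀ x → π j ≡ x → predecessorIn (sameBlock π) j ≡ x
      byPred zero    e = lastRelated≡0 (sameBlock π) j j λ s<j same →
        start-nothingBefore j<n e s<j (sameBlock⇒ same)
      byPred (suc i) e =
        lastRelated≡suc (sameBlock π) j j (pred< P j<n e) (⇒sameBlock (sym (blockMin-pred j<n e)))
        λ i<s s<j same → pred-nothingBetween j<n e i<s s<j (sameBlock⇒ same)

    sameBlock-standardEdge⇒pred : ∀ {i j} → j < n → StandardEdgeℕ (sameBlock π) i j → π j ≡ suc i
    sameBlock-standardEdge⇒pred j<n (i<j , same , none) =
      standardEdge⇒pred i<j j<n (sameBlock⇒ same) λ i<t t<j sameₜ → none i<t t<j (⇒sameBlock sameₜ)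

    IsNoncrossingRel-sameBlock : IsNoncrossingRel n (sameBlock π)
    IsNoncrossingRel-sameBlock = record
      { R-refl              = λ _ → ⇒sameBlock refl
      ; R-sym               = λ _ _ same → ⇒sameBlock (sym (sameBlock⇒ same))
      ; R-trans             = λ _ _ _ same same′ → ⇒sameBlock (trans (sameBlock⇒ same) (sameBlock⇒ same′))
      ; R-noDistantCrossing = λ j₂<n edge₁ edge₂ a<b b<j₁ j₁<j₂ → noDistantCrossing P j₂<n
          (sameBlock-standardEdge⇒pred (<-trans j₁<j₂ j₂<n) edge₁) (sameBlock-standardEdge⇒pred j₂<n edge₂)
          a<b b<j₁ j₁<j₂ }

  relationOf : ∀ {n} → Matrix n → ℕ → ℕ → Bool
  relationOf {n} M i j = lookupOr false (lookupOr (replicate n false) M i) j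

  relationOf-toℕ : ∀ {n} (M : Matrix n) (a b : Fin n) → relationOf M (toℕ a) (toℕ b) ≡ lookup (lookup M a) b
  relationOf-toℕ {n} M a b =
    trans (cong (λ row → lookupOr false row (toℕ b)) (lookupOr-toℕ (replicate n false) M a))
          (lookupOr-toℕ false (lookup M a) b)

  module MatrixRelation {n : ℕ} (M : Matrix n) where

    private
      R : ℕ → ℕ → Bool
      R = relationOf M

    sameBlock⇒R : ∀ {a b} → SameBlock M a b → T (R (toℕ a) (toℕ b))
    sameBlock⇒R {a} {b} = subst T (sym (relationOf-toℕ M a b))

    R⇒sameBlock : ∀ {a b} → T (R (toℕ a) (toℕ b)) → SameBlock M a b
    R⇒sameBlock {a} {b} = subst T (relationOf-toℕ M a b)

    R⇒sameBlockℕ : ∀ {i j} (i<n : i < n) (j<n : j < n) → T (R i j) →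
                   SameBlock M (fromℕ< i<n) (fromℕ< j<n)
    R⇒sameBlockℕ i<n j<n r =
      R⇒sameBlock (subst₂ (λ x y → T (R x y)) (sym (toℕ-fromℕ< i<n)) (sym (toℕ-fromℕ< j<n)) r)

    sameBlockℕ⇒R : ∀ {i j} (i<n : i < n) (j<n : j < n) →
                   SameBlock M (fromℕ< i<n) (fromℕ< j<n) → T (R i j)
    sameBlockℕ⇒R i<n j<n s =
      subst₂ (λ x y → T (R x y)) (toℕ-fromℕ< i<n) (toℕ-fromℕ< j<n) (sameBlock⇒R s)

    standardEdge⇒ℕ : ∀ {a b} → StandardEdge M a b → StandardEdgeℕ R (toℕ a) (toℕ b)
    standardEdge⇒ℕ {a} {b} (a<b , same , none) = a<b , sameBlock⇒R same , λ {t} a<t t<b r →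
      let t<n = <-trans t<b (toℕ<n b) in
      none (fromℕ< t<n) (subst (toℕ a <_) (sym (toℕ-fromℕ< t<n)) a<t)
        (subst (_< toℕ b) (sym (toℕ-fromℕ< t<n)) t<b)
        (R⇒sameBlock (subst (λ z → T (R (toℕ a) z)) (sym (toℕ-fromℕ< t<n)) r))

    ℕ⇒standardEdge : ∀ {i j} (i<n : i < n) (j<n : j < n) → StandardEdgeℕ R i j →
                     StandardEdge M (fromℕ< i<n) (fromℕ< j<n)
    ℕ⇒standardEdge i<n j<n (i<j , r , none) =
      subst₂ _<_ (sym (toℕ-fromℕ< i<n)) (sym (toℕ-fromℕ< j<n)) i<j , R⇒sameBlockℕ i<n j<n r ,
      λ t i<t t<j s → none (subst (_< toℕ t) (toℕ-fromℕ< i<n) i<t) (subst (toℕ t <_) (toℕ-fromℕ< j<n) t<j)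
        (subst (λ z → T (R z (toℕ t))) (toℕ-fromℕ< i<n) (sameBlock⇒R s))

    IsNoncrossingRel-relationOf : IsEquivalence (SameBlock M) → ¬ DistantCrossing 2 M → IsNoncrossingRel n R
    IsNoncrossingRel-relationOf E noCrossing = record
      { R-refl              = λ i<n → sameBlockℕ⇒R i<n i<n (IsEquivalence.refl E)
      ; R-sym               = λ i<n j<n r → sameBlockℕ⇒R j<n i<n (IsEquivalence.sym E (R⇒sameBlockℕ i<n j<n r))
      ; R-trans             = λ i<n j<n k<n r r′ → sameBlockℕ⇒R i<n k<n
          (IsEquivalence.trans E (R⇒sameBlockℕ i<n j<n r) (R⇒sameBlockℕ j<n k<n r′))
      ; R-noDistantCrossing = noDistantCrossing′ }
      where
      noDistantCrossing′ : ∀ {a j₁ b j₂} → j₂ < n → StandardEdgeℕ R a j₁ → StandardEdgeℕ R b j₂ →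
                           a < b → b < j₁ → j₁ < j₂ → j₁ ≤ suc b
      noDistantCrossing′ {a} {j₁} {b} {j₂} j₂<n edge₁ edge₂ a<b b<j₁ j₁<j₂ with j₁ ≤? suc b
      ... | yes j₁≤1+b = j₁≤1+b
      ... | no  j₁≰1+b = ⊥-elim (noCrossing
        ( fromℕ< a<n , fromℕ< j₁<n , fromℕ< b<n , fromℕ< j₂<n
        , ℕ⇒standardEdge a<n j₁<n edge₁ , ℕ⇒standardEdge b<n j₂<n edge₂
        , subst₂ _<_ (sym (toℕ-fromℕ< a<n)) (sym (toℕ-fromℕ< b<n)) a<b
        , subst₂ _<_ (sym (toℕ-fromℕ< b<n)) (sym (toℕ-fromℕ< j₁<n)) b<j₁
        , subst₂ _<_ (sym (toℕ-fromℕ< j₁<n)) (sym (toℕ-fromℕ< j₂<n)) j₁<j₂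
        , subst₂ (λ x y → 2 ≤ x ∸ y) (sym (toℕ-fromℕ< j₁<n)) (sym (toℕ-fromℕ< b<n))
                 (m+n≤o⇒m≤o∸n 2 (≰⇒> j₁≰1+b))))
        where
        j₁<n = <-trans j₁<j₂ j₂<n
        b<n  = <-trans b<j₁ j₁<n
        a<n  = <-trans a<b b<n

    IsNoncrossingRel⇒isEquivalence : IsNoncrossingRel n R → IsEquivalence (SameBlock M)
    IsNoncrossingRel⇒isEquivalence N = record
      { refl  = λ {a} → R⇒sameBlock (R-refl N (toℕ<n a))
      ; sym   = λ {a} {b} s → R⇒sameBlock (R-sym N (toℕ<n a) (toℕ<n b) (sameBlock⇒R s))
      ; trans = λ {a} {b} {c} s s′ →
          R⇒sameBlock (R-trans N (toℕ<n a) (toℕ<n b) (toℕ<n c) (sameBlock⇒R s) (sameBlock⇒R s′)) }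

    IsNoncrossingRel⇒noncrossing : IsNoncrossingRel n R → ¬ DistantCrossing 2 M
    IsNoncrossingRel⇒noncrossing N
      (i₁ , j₁ , i₂ , j₂ , edge₁ , edge₂ , i₁<i₂ , i₂<j₁ , j₁<j₂ , 2≤j₁∸i₂) =
      <⇒≱ (s≤s (m≤n+o⇒m∸n≤o (toℕ j₁) (toℕ i₂) (subst (toℕ j₁ ≤_) (+-comm 1 (toℕ i₂)) j₁≤1+i₂))) 2≤j₁∸i₂
      where
      j₁≤1+i₂ = R-noDistantCrossing N (toℕ<n j₂) (standardEdge⇒ℕ edge₁) (standardEdge⇒ℕ edge₂)
                  i₁<i₂ i₂<j₁ j₁<j₂

  IsNoncrossingRel-cong : ∀ {n R R′} → (∀ {i j} → i < n → j < n → R i j ≡ R′ i j) →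
                          IsNoncrossingRel n R → IsNoncrossingRel n R′
  IsNoncrossingRel-cong {n} {R} {R′} R≗R′ N = record
    { R-refl              = λ i<n → to i<n i<n (R-refl N i<n)
    ; R-sym               = λ i<n j<n r → to j<n i<n (R-sym N i<n j<n (from i<n j<n r))
    ; R-trans             = λ i<n j<n k<n r r′ →
        to i<n k<n (R-trans N i<n j<n k<n (from i<n j<n r) (from j<n k<n r′))
    ; R-noDistantCrossing = λ j₂<n edge₁ edge₂ a<b b<j₁ j₁<j₂ →
        R-noDistantCrossing N j₂<n (edge (<-trans j₁<j₂ j₂<n) edge₁) (edge j₂<n edge₂) a<b b<j₁ j₁<j₂ }
    where
    to : ∀ {i j} → i < n → j < n → T (R i j) → T (R′ i j)
    to i<n j<n = subst T (R≗R′ i<n j<n)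
    from : ∀ {i j} → i < n → j < n → T (R′ i j) → T (R i j)
    from i<n j<n = subst T (sym (R≗R′ i<n j<n))
    edge : ∀ {a j} → j < n → StandardEdgeℕ R′ a j → StandardEdgeℕ R a j
    edge j<n (a<j , r , none) = a<j , from (<-trans a<j j<n) j<n r ,
      λ a<t t<j r′ → none a<t t<j (to (<-trans a<j j<n) (<-trans t<j j<n) r′)

  -- Partitions and their predecessor vectors

  blocksOf : ∀ n → (ℕ → ℕ) → Matrix n
  blocksOf n π = tabulateℕ n λ i → tabulateℕ n (sameBlock π i)

  relationOf-blocksOf : ∀ {n} π {i j} → i < n → j < n → relationOf (blocksOf n π) i j ≡ sameBlock π i j
  relationOf-blocksOf {n} π {i} {j} i<n j<n =
    trans (cong (λ row → lookupOr false row j)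
                (lookupOr-tabulateℕ (replicate n false) n (λ i → tabulateℕ n (sameBlock π i)) i<n))
          (lookupOr-tabulateℕ false n (sameBlock π i) j<n)

  Matrix-ext : ∀ {n} {M M′ : Matrix n} →
               (∀ {i j} → i < n → j < n → relationOf M i j ≡ relationOf M′ i j) → M ≡ M′
  Matrix-ext {n} {M} {M′} M≗M′ =
    lookupOr-ext (replicate n false) M M′ λ i<n → lookupOr-ext false _ _ λ j<n → M≗M′ i<n j<n

  NoncrossingPartition-≡ : ∀ {k n} {p q : NoncrossingPartition k n} →
                           NoncrossingPartition.blocks p ≡ NoncrossingPartition.blocks q → p ≡ q
  NoncrossingPartition-≡ {p = record { blocks = M }} {record { blocks = .M }} refl = refl

  IsNoncrossingRel-blocksOf : ∀ {n π} → IsPredMap n π → IsNoncrossingRel n (relationOf (blocksOf n π))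
  IsNoncrossingRel-blocksOf {π = π} P =
    IsNoncrossingRel-cong (λ i<n j<n → sym (relationOf-blocksOf π i<n j<n))
      (FromPredMap.IsNoncrossingRel-sameBlock P)

  predecessorIn-blocksOf : ∀ {n π} → IsPredMap n π → ∀ {j} → j < n →
                           predecessorIn (relationOf (blocksOf n π)) j ≡ π j
  predecessorIn-blocksOf {n} {π} P {j} j<n =
    trans (lastRelated-cong j (λ t<j → relationOf-blocksOf π (<-trans t<j j<n) j<n))
          (FromPredMap.predecessorIn-sameBlock P j<n)

  blocksOf-predecessorIn : ∀ {n} {M : Matrix n} → IsNoncrossingRel n (relationOf M) →
    ∀ {i j} → i < n → j < n →
    relationOf (blocksOf n (lookupOr 0 (tabulateℕ n (predecessorIn (relationOf M))))) i j ≡ relationOf M i j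
  blocksOf-predecessorIn {n} {M} N i<n j<n =
    trans (relationOf-blocksOf π′ i<n j<n)
      (trans (cong₂ _≡ᵇ_ (blockMin≡ i<n) (blockMin≡ j<n)) (sym (FromRelation.R≡sameBlockMin N i<n j<n)))
    where
    π  = predecessorIn (relationOf M)
    π′ = lookupOr 0 (tabulateℕ n π)
    blockMin≡ : ∀ {k} → k < n → blockMin π′ k ≡ blockMin π k
    blockMin≡ = BlockMin.blockMin-cong (FromRelation.IsPredMap-predecessorIn N) (lookupOr-tabulateℕ 0 n π)

  NoncrossingPartition↔PredVec : ∀ n → NoncrossingPartition 2 n ↔ PredVec n
  NoncrossingPartition↔PredVec n = mk↔ₛ′ to from to∘from from∘to
    where
    to : NoncrossingPartition 2 n → PredVec n
    to record { blocks = M ; isPartition = E ; noncrossing = N } =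
      fromPredMap n (predecessorIn (relationOf M))
        (FromRelation.IsPredMap-predecessorIn (MatrixRelation.IsNoncrossingRel-relationOf M E N))

    from : PredVec n → NoncrossingPartition 2 n
    from (mkPredVec v P) = record
      { blocks      = blocksOf n π
      ; isPartition = MatrixRelation.IsNoncrossingRel⇒isEquivalence (blocksOf n π) (IsNoncrossingRel-blocksOf P)
      ; noncrossing = MatrixRelation.IsNoncrossingRel⇒noncrossing (blocksOf n π) (IsNoncrossingRel-blocksOf P) }
      where π = lookupOr 0 v

    to∘from : ∀ p → to (from p) ≡ p
    to∘from (mkPredVec v P) = PredVec-ext λ j<n →
      trans (lookupOr-tabulateℕ 0 n (predecessorIn (relationOf (blocksOf n (lookupOr 0 v)))) j<n)
            (recompute (_ ≟ _) (predecessorIn-blocksOf P j<n))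

    from∘to : ∀ x → from (to x) ≡ x
    from∘to record { blocks = M ; isPartition = E ; noncrossing = N } =
      NoncrossingPartition-≡ (Matrix-ext λ i<n j<n →
        recompute (_ Bool.≟ _)
          (blocksOf-predecessorIn {M = M} (MatrixRelation.IsNoncrossingRel-relationOf M E N) i<n j<n))

  discrete : ∀ n → PredVec n
  discrete n = fromPredMap n (λ _ → 0) record
    { pred< = λ _ () ; succ-unique = λ _ _ () ; noDistantCrossing = λ _ () }

  PredVec≤1-unique : ∀ {n} → n ≤ 1 → (p : PredVec n) → p ≡ discrete n
  PredVec≤1-unique {n} n≤1 (mkPredVec v P) = PredVec-ext agree
    where
    agree : ∀ {j} → j < n → lookupOr 0 v j ≡ lookupOr 0 (tabulateℕ n (λ _ → 0)) j
    agree {zero}  0<n =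
      trans (recompute (_ ≟ _) (pred-0≡0 P 0<n)) (sym (lookupOr-tabulateℕ 0 n (λ _ → 0) 0<n))
    agree {suc j} j<n with <-≤-trans j<n n≤1
    ... | s≤s ()

  Finite : Set → Set
  Finite A = Σ ℕ λ c → Fin c ↔ A

  module _ {A B : Set} where

    Finite-↔ : A ↔ B → Finite A → Finite B
    Finite-↔ A↔B (c , f) = c , ↔-trans f A↔B

    Finite-⊎ : Finite A → Finite B → Finite (A ⊎ B)
    Finite-⊎ (a , f) (b , g) = a + b , ↔-trans +↔⊎ (f ⊎-↔ g)

    Finite-× : Finite A → Finite B → Finite (A × B)
    Finite-× (a , f) (b , g) = a * b , ↔-trans *↔× (f ×-↔ g)

  Fin-sum↔Σ : ∀ {n} (f : Fin n → ℕ) → Fin (sum f) ↔ Σ (Fin n) (λ i → Fin (f i))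
  Fin-sum↔Σ {zero}  f = mk↔ₛ′ (λ ()) (λ ()) (λ ()) (λ ())
  Fin-sum↔Σ {suc n} f = ↔-trans +↔⊎ (↔-trans (↔-refl ⊎-↔ Fin-sum↔Σ (λ i → f (fsuc i))) merge)
    where
    merge : (Fin (f fzero) ⊎ Σ (Fin n) (λ i → Fin (f (fsuc i)))) ↔ Σ (Fin (suc n)) (λ i → Fin (f i))
    merge = mk↔ₛ′ (λ { (inj₁ x) → fzero , x ; (inj₂ (i , y)) → fsuc i , y })
                  (λ { (fzero , x) → inj₁ x ; (fsuc i , y) → inj₂ (i , y) })
                  (λ { (fzero , x) → refl ; (fsuc i , y) → refl })
                  (λ { (inj₁ x) → refl ; (inj₂ (i , y)) → refl })

  Finite-Σ : ∀ {n} {B : Fin n → Set} → (∀ i → Finite (B i)) → Finite (Σ (Fin n) B)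
  Finite-Σ B-finite =
    sum (λ i → proj₁ (B-finite i)) , ↔-trans (Fin-sum↔Σ _) (Σ-↔ ↔-refl (proj₂ (B-finite _)))

  Fin1↔PredVec≤1 : ∀ {n} → n ≤ 1 → Fin 1 ↔ PredVec n
  Fin1↔PredVec≤1 {n} n≤1 =
    mk↔ₛ′ (λ _ → discrete n) (λ _ → fzero) (λ p → sym (PredVec≤1-unique n≤1 p)) λ { fzero → refl ; (fsuc ()) }

  UnlinkedFinite : ℕ → Set
  UnlinkedFinite (suc (suc m)) = Finite (Unlinked m)
  UnlinkedFinite _             = ⊤

  finite : ∀ k → Finite (PredVec k) × UnlinkedFinite k
  finite = <-rec (λ k → Finite (PredVec k) × UnlinkedFinite k) step
    where
    step : ∀ k → (∀ {j} → j < k → Finite (PredVec j) × UnlinkedFinite j) →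
           Finite (PredVec k) × UnlinkedFinite k
    step zero          _  = (1 , Fin1↔PredVec≤1 z≤n) , tt
    step (suc zero)    _  = (1 , Fin1↔PredVec≤1 ≤-refl) , tt
    step (suc (suc n)) ih =
      Finite-↔ (↔-sym (PredVec↔Unlinked⊎PredVec n)) (Finite-⊎ unlinkedFinite previousFinite) , unlinkedFinite
      where
      previousFinite : Finite (PredVec (suc n))
      previousFinite = proj₁ (ih ≤-refl)
      unlinkedFinite : Finite (Unlinked n)
      unlinkedFinite = Finite-↔ (↔-sym (NestedDecomposition.Unlinked↔PredVec⊎Nested n))
        (Finite-⊎ previousFinite (Finite-Σ λ m →
          Finite-× (proj₂ (ih (s≤s (s≤s (toℕ<n m))))) (proj₁ (ih (s≤s (≤-trans (m∸n≤m n (toℕ m)) (n≤1+n n)))))))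

  count : ℕ → ℕ
  count k = proj₁ (proj₁ (finite k))

  Fin-count↔PredVec : ∀ k → Fin (count k) ↔ PredVec k
  Fin-count↔PredVec k = proj₂ (proj₁ (finite k))

  countUnlinked : ℕ → ℕ
  countUnlinked m = proj₁ (proj₂ (finite (suc (suc m))))

  Fin-countUnlinked↔Unlinked : ∀ m → Fin (countUnlinked m) ↔ Unlinked m
  Fin-countUnlinked↔Unlinked m = proj₂ (proj₂ (finite (suc (suc m))))

  count-0 : count 0 ≡ 1
  count-0 = ↔⇒≡ (↔-trans (Fin-count↔PredVec 0) (↔-sym (Fin1↔PredVec≤1 z≤n)))

  count-1 : count 1 ≡ 1
  count-1 = ↔⇒≡ (↔-trans (Fin-count↔PredVec 1) (↔-sym (Fin1↔PredVec≤1 ≤-refl)))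

  count-2+ : ∀ n → count (suc (suc n)) ≡ countUnlinked n + count (suc n)
  count-2+ n = ↔⇒≡ (↔-trans (Fin-count↔PredVec (suc (suc n))) (↔-trans (PredVec↔Unlinked⊎PredVec n)
    (↔-sym (↔-trans +↔⊎ (Fin-countUnlinked↔Unlinked n ⊎-↔ Fin-count↔PredVec (suc n))))))

  countUnlinked-eq : ∀ n →
    countUnlinked n ≡ count (suc n) + ∑[ m < n ] (countUnlinked (toℕ m) * count (n ∸ toℕ m))
  countUnlinked-eq n = ↔⇒≡ (↔-trans (Fin-countUnlinked↔Unlinked n)
    (↔-trans (NestedDecomposition.Unlinked↔PredVec⊎Nested n) (↔-sym (↔-trans +↔⊎
      (Fin-count↔PredVec (suc n) ⊎-↔ ↔-trans (Fin-sum↔Σ summand) (Σ-↔ ↔-refl pairs))))))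
    where
    summand : Fin n → ℕ
    summand m = countUnlinked (toℕ m) * count (n ∸ toℕ m)
    pairs : ∀ {m} → Fin (summand m) ↔ (Unlinked (toℕ m) × PredVec (n ∸ toℕ m))
    pairs {m} = ↔-trans *↔× (Fin-countUnlinked↔Unlinked (toℕ m) ×-↔ Fin-count↔PredVec (n ∸ toℕ m))

  count-2+-recurrence : ∀ n →
    count (suc (suc n)) ≡ 2 * count (suc n) + ∑[ m < n ] (countUnlinked (toℕ m) * count (n ∸ toℕ m))
  count-2+-recurrence n = begin
    count (suc (suc n))                           ≡⟨ count-2+ n ⟩
    countUnlinked n + count (suc n)               ≡⟨ cong (_+ count (suc n)) (countUnlinked-eq n) ⟩
    (count (suc n) + nestedCount) + count (suc n) ≡⟨ twice (count (suc n)) nestedCount ⟩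
    2 * count (suc n) + nestedCount               ∎
    where
    open ≡-Reasoning
    nestedCount : ℕ
    nestedCount = ∑[ m < n ] (countUnlinked (toℕ m) * count (n ∸ toℕ m))
    twice : ∀ a s → (a + s) + a ≡ 2 * a + s
    twice = solve-∀

  Fin-count↔NoncrossingPartition : ∀ n → Fin (count n) ↔ NoncrossingPartition 2 n
  Fin-count↔NoncrossingPartition n = ↔-trans (Fin-count↔PredVec n) (↔-sym (NoncrossingPartition↔PredVec n))

open import Defs
open import Data.Fin using (Fin; toℕ)
open import Data.Integer using (ℤ; +_; _+_; _-_; _*_)
open import Data.Integer.Properties using (pos-+; pos-*; [+m]-[+n]≡m⊖n; ⊖-≥)
open import Data.List using (map; applyUpTo; foldr)
import Data.Nat
open import Data.Nat using (ℕ; zero; suc; _∸_; s≤s) renaming (_+_ to _+ℕ_; _*_ to _*ℕ_)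
import Data.Nat.Properties
open import Data.Nat.Properties using (m≤n+m; m+n∸n≡m; *-comm)
open import Algebra.Properties.Monoid.Sum Data.Nat.Properties.+-0-monoid using (sum-syntax)
open import Data.Product using (Σ; _×_; _,_)
open import Function.Bundles using (_↔_)
open import Relation.Binary.PropositionalEquality using (_≡_; refl; sym; trans; cong; cong₂; module ≡-Reasoning)

open TwoDistantNoncrossing
  using (count; count-0; count-1; count-2+; count-2+-recurrence; countUnlinked; Fin-count↔NoncrossingPartition)

+[m+n]-+n≡+m : ∀ m n → + (m +ℕ n) - + n ≡ + m
+[m+n]-+n≡+m m n = trans ([+m]-[+n]≡m⊖n (m +ℕ n) n) (trans (⊖-≥ (m≤n+m n m)) (cong +_ (m+n∸n≡m m n)))

sumFrom2-2+ : ∀ n (F : ℕ → ℤ) (h : ℕ → ℕ) → (∀ m → F (2 +ℕ m) ≡ + h m) →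
              sumFrom2 (suc (suc n)) F ≡ + (∑[ m < n ] h (toℕ m))
sumFrom2-2+ n F = go n (2 +ℕ_)
  where
  go : ∀ k (g h : ℕ → ℕ) → (∀ m → F (g m) ≡ + h m) →
       foldr _+_ (+ 0) (map F (applyUpTo g k)) ≡ + (∑[ m < k ] h (toℕ m))
  go zero    g h _   = refl
  go (suc k) g h F≗h =
    trans (cong₂ _+_ (F≗h 0) (go k (λ m → g (suc m)) (λ m → h (suc m)) (λ m → F≗h (suc m))))
          (sym (pos-+ (h 0) _))

count-recurrence : ∀ n → 2 Data.Nat.≤ n →
  + count n ≡ + 2 * + count (n Data.Nat.∸ 1)
              + sumFrom2 n (λ i → + count (n Data.Nat.∸ i) * (+ count i - + count (i Data.Nat.∸ 1)))
count-recurrence (suc zero) (s≤s ())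
count-recurrence (suc (suc n)) _ = begin
  + count (suc (suc n))
    ≡⟨ cong +_ (count-2+-recurrence n) ⟩
  + (2 *ℕ count (suc n) +ℕ nestedCount)
    ≡⟨ pos-+ (2 *ℕ count (suc n)) nestedCount ⟩
  + (2 *ℕ count (suc n)) + + nestedCount
    ≡⟨ cong₂ _+_ (pos-* 2 (count (suc n))) (sym (sumFrom2-2+ n F _ summand)) ⟩
  + 2 * + count (suc n) + sumFrom2 (suc (suc n)) F ∎
  where
  open ≡-Reasoning
  nestedCount : ℕ
  nestedCount = ∑[ m < n ] (countUnlinked (toℕ m) *ℕ count (n ∸ toℕ m))
  F : ℕ → ℤ
  F i = + count (suc (suc n) ∸ i) * (+ count i - + count (i ∸ 1))
  summand : ∀ m → F (2 +ℕ m) ≡ + (countUnlinked m *ℕ count (n ∸ m))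
  summand m = begin
    + count (n ∸ m) * (+ count (suc (suc m)) - + count (suc m))
      ≡⟨ cong (λ c → + count (n ∸ m) * (+ c - + count (suc m))) (count-2+ m) ⟩
    + count (n ∸ m) * (+ (countUnlinked m +ℕ count (suc m)) - + count (suc m))
      ≡⟨ cong (+ count (n ∸ m) *_) (+[m+n]-+n≡+m (countUnlinked m) (count (suc m))) ⟩
    + count (n ∸ m) * + countUnlinked m
      ≡⟨ sym (pos-* (count (n ∸ m)) (countUnlinked m)) ⟩
    + (count (n ∸ m) *ℕ countUnlinked m)
      ≡⟨ cong +_ (*-comm (count (n ∸ m)) (countUnlinked m)) ⟩
    + (countUnlinked m *ℕ count (n ∸ m)) ∎

theorem3p1 :
    Σ (ℕ → ℕ) λ d₂ →
      (∀ n → Fin (d₂ n) ↔ NoncrossingPartition 2 n) ×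
      d₂ 0 ≡ 1 × d₂ 1 ≡ 1 ×
      (∀ n → 2 Data.Nat.≤ n →
        + d₂ n ≡ + 2 * + d₂ (n Data.Nat.∸ 1)
                 + sumFrom2 n (λ i → + d₂ (n Data.Nat.∸ i) * (+ d₂ i - + d₂ (i Data.Nat.∸ 1))))
theorem3p1 = count , Fin-count↔NoncrossingPartition , count-0 , count-1 , count-recurrence
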